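{- If $G$ is a König–Egerváry graph, then both $\mathrm{core}(G)$ and $\mathrm{corona}(G)$ are critical sets. Moreover, $\mathrm{corona}(G)$ equals the union of all maximum critical independent sets of $G$.
   Context: $G$ is a finite simple graph. For $X\subseteq V(G)$, $N(X)$ is the set of vertices adjacent to some vertex of $X$, $d(X)=|X|-|N(X)|$, $d(G)=\max\{d(X):X\subseteq V(G)\}$, and $X$ is critical if $d(X)=d(G)$. An independent set $A$ is a critical independent set if $d(A)=\max\{d(I): I \text{ independent}\}$ (which equals $d(G)$); a maximum critical independent set is a critical independent set of largest cardinality among critical independent sets. $\alpha(G)$ is the maximum size of an independent set, $\Omega(G)$ is the family of maximum independent sets, $\mathrm{core}(G)=\bigcap\Omega(G)$, $\mathrm{corona}(G)=\bigcup\Omega(G)$. $\mu(G)$ is the size of a maximum matching. $G$ is a König–Egerváry graph if $\alpha(G)+\mu(G)=|V(G)|$. -}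

module Defs where

open import Data.Nat using (ℕ; zero; suc)
open import Data.Bool using (Bool; true; false; _∧_; _∨_)
open import Data.Fin using (Fin)
open import Data.Fin.Subset using (Subset; _∈_; ∣_∣)
open import Data.Vec using (lookup; tabulate)
open import Data.Integer using (ℤ; +_; _-_; _≤_)
open import Data.Product using (Σ; ∃; _×_; proj₁; proj₂)
open import Data.Sum using (_⊎_; inj₁; inj₂)
open import Function.Definitions using (Injective)
open import Relation.Binary.PropositionalEquality using (_≡_)
open import Relation.Nullary using (¬_)
import Data.Nat as ℕ

record Graph (n : ℕ) : Set where
  field
    adj    : Fin n → Fin n → Bool
    sym    : ∀ u v → adj u v ≡ adj v u
    irrefl : ∀ v → adj v v ≡ false
open Graph public

anyFin : {n : ℕ} → (Fin n → Bool) → Bool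
anyFin {zero}  f = false
anyFin {suc n} f = f Fin.zero ∨ anyFin (λ i → f (Fin.suc i))

module _ {n : ℕ} (G : Graph n) where

  N : Subset n → Subset n
  N X = tabulate (λ v → anyFin (λ u → lookup X u ∧ adj G u v))

  d : Subset n → ℤ
  d X = + ∣ X ∣ - + ∣ N X ∣

  Critical : Subset n → Set
  Critical X = ∀ Y → d Y ≤ d X

  Independent : Subset n → Set
  Independent X = ∀ u v → u ∈ X → v ∈ X → adj G u v ≡ false

  CriticalIndependent : Subset n → Set
  CriticalIndependent A = Independent A × (∀ I → Independent I → d I ≤ d A)

  MaximumCriticalIndependent : Subset n → Set
  MaximumCriticalIndependent A =
    CriticalIndependent A × (∀ B → CriticalIndependent B → ∣ B ∣ ℕ.≤ ∣ A ∣)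

  MaximumIndependent : Subset n → Set
  MaximumIndependent S = Independent S × (∀ I → Independent I → ∣ I ∣ ℕ.≤ ∣ S ∣)

  IsAlpha : ℕ → Set
  IsAlpha a = Σ (Subset n) (λ S → MaximumIndependent S × ∣ S ∣ ≡ a)

  IsMatching : (k : ℕ) → (Fin k → Fin n × Fin n) → Set
  IsMatching k f =
    (∀ i → adj G (proj₁ (f i)) (proj₂ (f i)) ≡ true) ×
    Injective _≡_ _≡_ (λ (x : Fin k ⊎ Fin k) → ends x)
    where
      ends : Fin k ⊎ Fin k → Fin n
      ends (inj₁ i) = proj₁ (f i)
      ends (inj₂ i) = proj₂ (f i)

  IsMu : ℕ → Set
  IsMu m = Σ (Fin m → Fin n × Fin n) (IsMatching m) ×
           (∀ k (f : Fin k → Fin n × Fin n) → IsMatching k f → k ℕ.≤ m)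

  KonigEgervary : Set
  KonigEgervary = Σ ℕ λ a → Σ ℕ λ m → IsAlpha a × IsMu m × a ℕ.+ m ≡ n

  IsCore : Subset n → Set
  IsCore X = ∀ v → (v ∈ X → ∀ S → MaximumIndependent S → v ∈ S)
                 × ((∀ S → MaximumIndependent S → v ∈ S) → v ∈ X)

  IsCorona : Subset n → Set
  IsCorona X = ∀ v → (v ∈ X → Σ (Subset n) λ S → MaximumIndependent S × v ∈ S)
                   × ((Σ (Subset n) λ S → MaximumIndependent S × v ∈ S) → v ∈ X)

  IsUnionMaxCritIndep : Subset n → Set
  IsUnionMaxCritIndep X =
    ∀ v → (v ∈ X → Σ (Subset n) λ A → MaximumCriticalIndependent A × v ∈ A)
        × ((Σ (Subset n) λ A → MaximumCriticalIndependent A × v ∈ A) → v ∈ X)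

-- Weight each vertex v by 1 − [v ∈ Y] + [v ∈ N(Y)]. The two ends of a matching edge weigh at
-- least 2 together, and all vertices weigh n − d(Y), so d(Y) ≤ n − 2μ for every Y. An independent
-- S is disjoint from N(S), so d(S) ≥ 2|S| − n, which is n − 2μ when |S| + μ = n: in a
-- König–Egerváry graph every maximum independent set is critical. The deficiency d is
-- supermodular, hence critical sets are closed under ∩ and ∪, and core and corona, being the
-- intersection and the union of the finitely many maximum independent sets, are critical.
-- Since maximum independent sets are critical, they are exactly the maximum critical
-- independent sets.
module Submission where

import Data.Nat.Properties as NP
open import Algebra.Properties.CommutativeMonoid.Sum NP.+-0-commutativeMonoid
  using (sum; sum-cong-≗; sum-remove; ∑-distrib-+)
open import Data.Bool using (Bool; true; false; not; _∧_)
import Data.Bool.Properties as BP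
open import Data.Fin using (Fin; zero; suc; _↑ˡ_; _↑ʳ_; splitAt; join; punchIn; punchOut)
import Data.Fin.Properties as FP
open import Data.Fin.Subset
  using (Subset; inside; outside; _∈_; _⊆_; ∣_∣; _∪_; _∩_; ∁; ⊥; ⋂; ⋃)
open import Data.Fin.Subset.Properties
  using (_∈?_; ∈⊤; ∉⊥; ⊆-antisym; ∣p∣≤n; ∣⊥∣≡0; ∣∁p∣≡n∸∣p∣; p⊆q⇒∣p∣≤∣q∣;
         x∈p∩q⁺; x∈p∩q⁻; x∈p∪q⁺; x∈p∪q⁻; ∩-identityʳ; ∪-identityʳ)
open import Data.Integer as ℤ using (-_; +≤+)
import Data.Integer.Properties as ZP
import Data.Integer.Tactic.RingSolver as ℤ-Solver
open import Data.List using (List; []; _∷_; map; _++_; filter)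
import Data.List.Membership.Propositional as List
open import Data.List.Membership.Propositional.Properties
  using (∈-map⁺; ∈-++⁺ˡ; ∈-++⁺ʳ; ∈-filter⁺; ∈-filter⁻)
open import Data.List.Relation.Unary.All as All using (All; []; _∷_)
open import Data.List.Relation.Unary.Any using (Any; here; there)
open import Data.Nat using (ℕ; zero; suc; _+_; _*_; _≤_; z≤n; s≤s)
import Data.Nat.Tactic.RingSolver as ℕ-Solver
open import Data.Product using (Σ; ∃; _×_; _,_; proj₁; proj₂)
open import Data.Sum using (_⊎_; inj₁; inj₂; [_,_]′)
open import Data.Vec using ([]; _∷_; lookup)
import Data.Vec.Properties as VP
open import Function using (_∘_)
open import Function.Definitions using (Injective)
open import Relation.Binary.PropositionalEquality
open import Relation.Nullary using (contradiction)
open import Relation.Nullary.Decidable using (map′; _×-dec_; _→-dec_)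
open import Relation.Unary using (Decidable)

open import Defs hiding (sym)

toℕ : Bool → ℕ
toℕ false = 0
toℕ true  = 1

∈⇒lookup : ∀ {n} {p : Subset n} {v} → v ∈ p → lookup p v ≡ true
∈⇒lookup = VP.[]=⇒lookup

lookup⇒∈ : ∀ {n} {p : Subset n} {v} → lookup p v ≡ true → v ∈ p
lookup⇒∈ {p = p} {v} = VP.lookup⇒[]= v p

anyFin≡true⁺ : ∀ {n} (f : Fin n → Bool) {u} → f u ≡ true → anyFin f ≡ true
anyFin≡true⁺ f {zero}  fu≡true rewrite fu≡true = refl
anyFin≡true⁺ f {suc u} fu≡true rewrite anyFin≡true⁺ (f ∘ suc) fu≡true = BP.∨-zeroʳ (f zero)

anyFin≡true⁻ : ∀ {n} (f : Fin n → Bool) → anyFin f ≡ true → ∃ λ u → f u ≡ true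
anyFin≡true⁻ {suc n} f any≡true with f zero in f₀≡
... | true  = zero , f₀≡
... | false = let u , fu≡true = anyFin≡true⁻ (f ∘ suc) any≡true in suc u , fu≡true

∣p∣≡∑ : ∀ {n} (p : Subset n) → ∣ p ∣ ≡ sum (λ v → toℕ (lookup p v))
∣p∣≡∑ []          = refl
∣p∣≡∑ (true ∷ p)  = cong suc (∣p∣≡∑ p)
∣p∣≡∑ (false ∷ p) = ∣p∣≡∑ p

∣p∣+∣∁p∣≡n : ∀ {n} (p : Subset n) → ∣ p ∣ + ∣ ∁ p ∣ ≡ n
∣p∣+∣∁p∣≡n p = trans (cong (_+_ ∣ p ∣) (∣∁p∣≡n∸∣p∣ p)) (NP.m+[n∸m]≡n (∣p∣≤n p))

∣p∪q∣+∣p∩q∣≡∣p∣+∣q∣ : ∀ {n} (p q : Subset n) → ∣ p ∪ q ∣ + ∣ p ∩ q ∣ ≡ ∣ p ∣ + ∣ q ∣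
∣p∪q∣+∣p∩q∣≡∣p∣+∣q∣ [] [] = refl
∣p∪q∣+∣p∩q∣≡∣p∣+∣q∣ (true ∷ p) (true ∷ q) = cong suc (begin
  ∣ p ∪ q ∣ + suc ∣ p ∩ q ∣ ≡⟨ NP.+-suc _ _ ⟩
  suc (∣ p ∪ q ∣ + ∣ p ∩ q ∣) ≡⟨ cong suc (∣p∪q∣+∣p∩q∣≡∣p∣+∣q∣ p q) ⟩
  suc (∣ p ∣ + ∣ q ∣) ≡⟨ NP.+-suc _ _ ⟨
  ∣ p ∣ + suc ∣ q ∣ ∎)
  where open ≡-Reasoning
∣p∪q∣+∣p∩q∣≡∣p∣+∣q∣ (true ∷ p) (false ∷ q) = cong suc (∣p∪q∣+∣p∩q∣≡∣p∣+∣q∣ p q)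
∣p∪q∣+∣p∩q∣≡∣p∣+∣q∣ (false ∷ p) (true ∷ q) =
  trans (cong suc (∣p∪q∣+∣p∩q∣≡∣p∣+∣q∣ p q)) (sym (NP.+-suc _ _))
∣p∪q∣+∣p∩q∣≡∣p∣+∣q∣ (false ∷ p) (false ∷ q) = ∣p∪q∣+∣p∩q∣≡∣p∣+∣q∣ p q

sum-↑ˡ-↑ʳ : ∀ m k (f : Fin (m + k) → ℕ) → sum f ≡ sum (f ∘ (_↑ˡ k)) + sum (f ∘ (m ↑ʳ_))
sum-↑ˡ-↑ʳ zero    k f = refl
sum-↑ˡ-↑ʳ (suc m) k f =
  trans (cong (_+_ (f zero)) (sum-↑ˡ-↑ʳ m k (f ∘ suc))) (sym (NP.+-assoc (f zero) _ _))

sum-lowerBound : ∀ {m} k (f : Fin m → ℕ) → (∀ i → k ≤ f i) → m * k ≤ sum f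
sum-lowerBound {zero}  k f k≤f = z≤n
sum-lowerBound {suc m} k f k≤f = NP.+-mono-≤ (k≤f zero) (sum-lowerBound k (f ∘ suc) (k≤f ∘ suc))

sum-∘-injective-≤ : ∀ {k n} (c : Fin n → ℕ) {e : Fin k → Fin n} →
                    Injective _≡_ _≡_ e → sum (c ∘ e) ≤ sum c
sum-∘-injective-≤ {zero}          c     _           = z≤n
sum-∘-injective-≤ {suc k} {zero}  c {e} _           = contradiction (e zero) FP.¬Fin0
sum-∘-injective-≤ {suc k} {suc n} c {e} e-injective = begin
  c (e zero) + sum (c ∘ e ∘ suc)
    ≡⟨ cong (_+_ (c (e zero))) (sum-cong-≗ (λ j → cong c (FP.punchIn-punchOut (e₀≢ j)))) ⟨
  c (e zero) + sum (c ∘ punchIn (e zero) ∘ e′)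
    ≤⟨ NP.+-monoʳ-≤ (c (e zero)) (sum-∘-injective-≤ (c ∘ punchIn (e zero)) e′-injective) ⟩
  c (e zero) + sum (c ∘ punchIn (e zero))
    ≡⟨ sum-remove c ⟨
  sum c ∎
  where
  open NP.≤-Reasoning
  e₀≢ : ∀ j → e zero ≢ e (suc j)
  e₀≢ j = FP.0≢1+n ∘ e-injective
  e′ : Fin k → Fin n
  e′ j = punchOut (e₀≢ j)
  e′-injective : Injective _≡_ _≡_ e′
  e′-injective = FP.suc-injective ∘ e-injective ∘ FP.punchOut-injective (e₀≢ _) (e₀≢ _)

2≤edgeWeight : ∀ y₁ b₁ y₂ b₂ → (y₁ ≡ true → b₂ ≡ true) → (y₂ ≡ true → b₁ ≡ true) →
               2 ≤ (toℕ (not y₁) + toℕ b₁) + (toℕ (not y₂) + toℕ b₂)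
2≤edgeWeight true  b₁ true  b₂ y₁⇒b₂ y₂⇒b₁ rewrite y₁⇒b₂ refl | y₂⇒b₁ refl = NP.≤-refl
2≤edgeWeight true  b₁ false b₂ y₁⇒b₂ _     rewrite y₁⇒b₂ refl = NP.m≤n+m 2 (toℕ b₁)
2≤edgeWeight false b₁ true  b₂ _     y₂⇒b₁ rewrite y₂⇒b₁ refl = NP.m≤m+n 2 (toℕ b₂)
2≤edgeWeight false b₁ false b₂ _     _     = NP.+-mono-≤ (s≤s z≤n) (s≤s z≤n)

[+m]-[+n]≤[+o]-[+p] : ∀ a b c d → a + d ≤ c + b →
                      ℤ.+ a ℤ.- ℤ.+ b ℤ.≤ ℤ.+ c ℤ.- ℤ.+ d
[+m]-[+n]≤[+o]-[+p] a b c d a+d≤c+b = begin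
  ℤ.+ a ℤ.- ℤ.+ b                          ≡⟨ shift (ℤ.+ a) (ℤ.+ b) (ℤ.+ d) ⟨
  ℤ.+ (a + d) ℤ.- ℤ.+ (b + d)              ≤⟨ ZP.+-monoˡ-≤ (- ℤ.+ (b + d)) (+≤+ a+d≤c+b) ⟩
  ℤ.+ (c + b) ℤ.- ℤ.+ (b + d)              ≡⟨ unshift (ℤ.+ c) (ℤ.+ b) (ℤ.+ d) ⟩
  ℤ.+ c ℤ.- ℤ.+ d ∎
  where
  open ZP.≤-Reasoning
  shift : ∀ x y z → (x ℤ.+ z) ℤ.- (y ℤ.+ z) ≡ x ℤ.- y
  shift = ℤ-Solver.solve-∀
  unshift : ∀ x y z → (x ℤ.+ y) ℤ.- (y ℤ.+ z) ≡ x ℤ.- z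
  unshift = ℤ-Solver.solve-∀

[+m]-[+n]+[+o]-[+p]≡[+m+o]-[+n+p] : ∀ a b c d →
  (ℤ.+ a ℤ.- ℤ.+ b) ℤ.+ (ℤ.+ c ℤ.- ℤ.+ d) ≡ ℤ.+ (a + c) ℤ.- ℤ.+ (b + d)
[+m]-[+n]+[+o]-[+p]≡[+m+o]-[+n+p] a b c d = interchange (ℤ.+ a) (ℤ.+ b) (ℤ.+ c) (ℤ.+ d)
  where
  interchange : ∀ w x y z → (w ℤ.- x) ℤ.+ (y ℤ.- z) ≡ (w ℤ.+ y) ℤ.- (x ℤ.+ z)
  interchange = ℤ-Solver.solve-∀

+-cancelˡ-≤ : ∀ i {j k} → i ℤ.+ j ℤ.≤ i ℤ.+ k → j ℤ.≤ k
+-cancelˡ-≤ i {j} {k} i+j≤i+k =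
  subst₂ ℤ._≤_ (cancel i j) (cancel i k) (ZP.+-monoʳ-≤ (- i) i+j≤i+k)
  where
  cancel : ∀ x y → - x ℤ.+ (x ℤ.+ y) ≡ y
  cancel = ℤ-Solver.solve-∀

+-cancelʳ-≤ : ∀ i {j k} → j ℤ.+ i ℤ.≤ k ℤ.+ i → j ℤ.≤ k
+-cancelʳ-≤ i {j} {k} j+i≤k+i =
  +-cancelˡ-≤ i (subst₂ ℤ._≤_ (ZP.+-comm j i) (ZP.+-comm k i) j+i≤k+i)

subsets : ∀ n → List (Subset n)
subsets zero    = [] ∷ []
subsets (suc n) = map (inside ∷_) (subsets n) ++ map (outside ∷_) (subsets n)

∈-subsets : ∀ {n} (p : Subset n) → p List.∈ subsets n
∈-subsets []                    = here refl
∈-subsets {suc n} (inside ∷ p)  = ∈-++⁺ˡ (∈-map⁺ (inside ∷_) (∈-subsets p))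
∈-subsets {suc n} (outside ∷ p) =
  ∈-++⁺ʳ (map (inside ∷_) (subsets n)) (∈-map⁺ (outside ∷_) (∈-subsets p))

x∈⋂⁺ : ∀ {n} {x : Fin n} {ps} → All (x ∈_) ps → x ∈ ⋂ ps
x∈⋂⁺ []             = ∈⊤
x∈⋂⁺ (x∈p ∷ x∈ps)  = x∈p∩q⁺ (x∈p , x∈⋂⁺ x∈ps)

x∈⋂⁻ : ∀ {n} {x : Fin n} ps → x ∈ ⋂ ps → All (x ∈_) ps
x∈⋂⁻ []       _        = []
x∈⋂⁻ (p ∷ ps) x∈p∩⋂ps =
  let x∈p , x∈⋂ps = x∈p∩q⁻ p (⋂ ps) x∈p∩⋂ps in x∈p ∷ x∈⋂⁻ ps x∈⋂ps

x∈⋃⁺ : ∀ {n} {x : Fin n} {ps} → Any (x ∈_) ps → x ∈ ⋃ ps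
x∈⋃⁺ (here x∈p)    = x∈p∪q⁺ (inj₁ x∈p)
x∈⋃⁺ (there x∈⋃ps) = x∈p∪q⁺ (inj₂ (x∈⋃⁺ x∈⋃ps))

x∈⋃⁻ : ∀ {n} {x : Fin n} ps → x ∈ ⋃ ps → Any (x ∈_) ps
x∈⋃⁻ []       x∈⊥       = contradiction x∈⊥ ∉⊥
x∈⋃⁻ (p ∷ ps) x∈p∪⋃ps with x∈p∪q⁻ p (⋃ ps) x∈p∪⋃ps
... | inj₁ x∈p   = here x∈p
... | inj₂ x∈⋃ps = there (x∈⋃⁻ ps x∈⋃ps)

module _ {n : ℕ} (G : Graph n) where

  ∈N⁺ : ∀ {X u v} → u ∈ X → adj G u v ≡ true → v ∈ N G X
  ∈N⁺ {X} {u} {v} u∈X uv≡true = lookup⇒∈ (trans (VP.lookup∘tabulate _ v)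
    (anyFin≡true⁺ (λ w → lookup X w ∧ adj G w v) (cong₂ _∧_ (∈⇒lookup u∈X) uv≡true)))

  ∈N⁻ : ∀ {X v} → v ∈ N G X → ∃ λ u → u ∈ X × adj G u v ≡ true
  ∈N⁻ {X} {v} v∈NX =
    let u , Xu∧uv≡true = anyFin≡true⁻ _ (trans (sym (VP.lookup∘tabulate _ v)) (∈⇒lookup v∈NX))
    in u , lookup⇒∈ (BP.∧-conicalˡ _ _ Xu∧uv≡true) , BP.∧-conicalʳ _ _ Xu∧uv≡true

  N-∪-⊆ : ∀ A B → N G (A ∪ B) ⊆ N G A ∪ N G B
  N-∪-⊆ A B v∈N[A∪B] with ∈N⁻ v∈N[A∪B]
  ... | u , u∈A∪B , uv≡true with x∈p∪q⁻ A B u∈A∪B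
  ... | inj₁ u∈A = x∈p∪q⁺ (inj₁ (∈N⁺ u∈A uv≡true))
  ... | inj₂ u∈B = x∈p∪q⁺ (inj₂ (∈N⁺ u∈B uv≡true))

  N-∩-⊆ : ∀ A B → N G (A ∩ B) ⊆ N G A ∩ N G B
  N-∩-⊆ A B v∈N[A∩B] with ∈N⁻ v∈N[A∩B]
  ... | u , u∈A∩B , uv≡true =
    let u∈A , u∈B = x∈p∩q⁻ A B u∈A∩B in x∈p∩q⁺ (∈N⁺ u∈A uv≡true , ∈N⁺ u∈B uv≡true)

  d-supermodular : ∀ A B → d G A ℤ.+ d G B ℤ.≤ d G (A ∪ B) ℤ.+ d G (A ∩ B)
  d-supermodular A B = begin
    d G A ℤ.+ d G B
      ≡⟨ [+m]-[+n]+[+o]-[+p]≡[+m+o]-[+n+p] (∣ A ∣) (∣ N G A ∣) (∣ B ∣) (∣ N G B ∣) ⟩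
    ℤ.+ (∣ A ∣ + ∣ B ∣) ℤ.- ℤ.+ (∣ N G A ∣ + ∣ N G B ∣)
      ≤⟨ [+m]-[+n]≤[+o]-[+p] _ (∣ N G A ∣ + ∣ N G B ∣) _ (∣ N G (A ∪ B) ∣ + ∣ N G (A ∩ B) ∣)
           (NP.+-mono-≤ (NP.≤-reflexive (sym (∣p∪q∣+∣p∩q∣≡∣p∣+∣q∣ A B)))
                        ∣N[A∪B]∣+∣N[A∩B]∣≤∣NA∣+∣NB∣) ⟩
    ℤ.+ (∣ A ∪ B ∣ + ∣ A ∩ B ∣) ℤ.- ℤ.+ (∣ N G (A ∪ B) ∣ + ∣ N G (A ∩ B) ∣)
      ≡⟨ [+m]-[+n]+[+o]-[+p]≡[+m+o]-[+n+p]
           (∣ A ∪ B ∣) (∣ N G (A ∪ B) ∣) (∣ A ∩ B ∣) (∣ N G (A ∩ B) ∣) ⟨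
    d G (A ∪ B) ℤ.+ d G (A ∩ B) ∎
    where
    open ZP.≤-Reasoning
    ∣N[A∪B]∣+∣N[A∩B]∣≤∣NA∣+∣NB∣ : ∣ N G (A ∪ B) ∣ + ∣ N G (A ∩ B) ∣ ≤ ∣ N G A ∣ + ∣ N G B ∣
    ∣N[A∪B]∣+∣N[A∩B]∣≤∣NA∣+∣NB∣ = NP.≤-trans
      (NP.+-mono-≤ (p⊆q⇒∣p∣≤∣q∣ (N-∪-⊆ A B)) (p⊆q⇒∣p∣≤∣q∣ (N-∩-⊆ A B)))
      (NP.≤-reflexive (∣p∪q∣+∣p∩q∣≡∣p∣+∣q∣ (N G A) (N G B)))

  ∩-critical : ∀ A B → Critical G A → Critical G B → Critical G (A ∩ B)
  ∩-critical A B A-critical B-critical Y = ZP.≤-trans (B-critical Y) (+-cancelˡ-≤ (d G A)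
    (ZP.≤-trans (d-supermodular A B) (ZP.+-monoˡ-≤ (d G (A ∩ B)) (A-critical (A ∪ B)))))

  ∪-critical : ∀ A B → Critical G A → Critical G B → Critical G (A ∪ B)
  ∪-critical A B A-critical B-critical Y = ZP.≤-trans (A-critical Y) (+-cancelʳ-≤ (d G B)
    (ZP.≤-trans (d-supermodular A B) (ZP.+-monoʳ-≤ (d G (A ∪ B)) (B-critical (A ∩ B)))))

  ⋂-critical : ∀ S ps → Critical G S → All (Critical G) ps → Critical G (⋂ (S ∷ ps))
  ⋂-critical S []       S-critical []                 =
    subst (Critical G) (sym (∩-identityʳ S)) S-critical
  ⋂-critical S (T ∷ ps) S-critical (T-critical ∷ cps) =
    ∩-critical S (⋂ (T ∷ ps)) S-critical (⋂-critical T ps T-critical cps)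

  ⋃-critical : ∀ S ps → Critical G S → All (Critical G) ps → Critical G (⋃ (S ∷ ps))
  ⋃-critical S []       S-critical []                 =
    subst (Critical G) (sym (∪-identityʳ S)) S-critical
  ⋃-critical S (T ∷ ps) S-critical (T-critical ∷ cps) =
    ∪-critical S (⋃ (T ∷ ps)) S-critical (⋃-critical T ps T-critical cps)

  independent⇒∣S∣+∣NS∣≤n : ∀ {S} → Independent G S → ∣ S ∣ + ∣ N G S ∣ ≤ n
  independent⇒∣S∣+∣NS∣≤n {S} S-independent = begin
    ∣ S ∣ + ∣ N G S ∣             ≡⟨ ∣p∪q∣+∣p∩q∣≡∣p∣+∣q∣ S (N G S) ⟨
    ∣ S ∪ N G S ∣ + ∣ S ∩ N G S ∣ ≤⟨ NP.+-mono-≤ (∣p∣≤n (S ∪ N G S)) (p⊆q⇒∣p∣≤∣q∣ S∩NS⊆⊥) ⟩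
    n + ∣ ⊥ {n} ∣                 ≡⟨ cong (_+_ n) (∣⊥∣≡0 n) ⟩
    n + 0                         ≡⟨ NP.+-identityʳ n ⟩
    n ∎
    where
    open NP.≤-Reasoning
    S∩NS⊆⊥ : S ∩ N G S ⊆ ⊥ {n}
    S∩NS⊆⊥ {v} v∈S∩NS with x∈p∩q⁻ S (N G S) v∈S∩NS
    ... | v∈S , v∈NS with ∈N⁻ v∈NS
    ... | u , u∈S , uv≡true = contradiction (trans (sym uv≡true) (S-independent u v u∈S v∈S)) λ ()

  endpoint : ∀ {m} → (Fin m → Fin n × Fin n) → Fin m ⊎ Fin m → Fin n
  endpoint f (inj₁ i) = proj₁ (f i)
  endpoint f (inj₂ i) = proj₂ (f i)

  endpoint-injective : ∀ {m f} → IsMatching G m f → Injective _≡_ _≡_ (endpoint f)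
  endpoint-injective (_ , ends-injective) {inj₁ i} {inj₁ j} = ends-injective {inj₁ i} {inj₁ j}
  endpoint-injective (_ , ends-injective) {inj₁ i} {inj₂ j} = ends-injective {inj₁ i} {inj₂ j}
  endpoint-injective (_ , ends-injective) {inj₂ i} {inj₁ j} = ends-injective {inj₂ i} {inj₁ j}
  endpoint-injective (_ , ends-injective) {inj₂ i} {inj₂ j} = ends-injective {inj₂ i} {inj₂ j}

  matching-∑-≤ : ∀ {m f} → IsMatching G m f → (c : Fin n → ℕ) →
                 sum (λ i → c (proj₁ (f i)) + c (proj₂ (f i))) ≤ sum c
  matching-∑-≤ {m} {f} M c = begin
    sum (λ i → c (proj₁ (f i)) + c (proj₂ (f i)))
      ≡⟨ ∑-distrib-+ (c ∘ proj₁ ∘ f) (c ∘ proj₂ ∘ f) ⟩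
    sum (c ∘ proj₁ ∘ f) + sum (c ∘ proj₂ ∘ f)
      ≡⟨ cong₂ _+_ (sum-cong-≗ (λ i → cong (c ∘ endpoint f) (FP.splitAt-↑ˡ m i m)))
                   (sum-cong-≗ (λ i → cong (c ∘ endpoint f) (FP.splitAt-↑ʳ m m i))) ⟨
    sum (c ∘ e ∘ (_↑ˡ m)) + sum (c ∘ e ∘ (m ↑ʳ_))
      ≡⟨ sum-↑ˡ-↑ʳ m m (c ∘ e) ⟨
    sum (c ∘ e)
      ≤⟨ sum-∘-injective-≤ c (splitAt-injective ∘ endpoint-injective M) ⟩
    sum c ∎
    where
    open NP.≤-Reasoning
    e : Fin (m + m) → Fin n
    e = endpoint f ∘ splitAt m
    splitAt-injective : Injective _≡_ _≡_ (splitAt m {m})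
    splitAt-injective {x} {y} x≡y =
      trans (sym (FP.join-splitAt m m x)) (trans (cong (join m m) x≡y) (FP.join-splitAt m m y))

  matching⇒∣Y∣+m*2≤n+∣NY∣ : ∀ {m f} → IsMatching G m f → ∀ Y → ∣ Y ∣ + m * 2 ≤ n + ∣ N G Y ∣
  matching⇒∣Y∣+m*2≤n+∣NY∣ {m} {f} M@(edges , _) Y = begin
    ∣ Y ∣ + m * 2                 ≤⟨ NP.+-monoʳ-≤ (∣ Y ∣) (NP.≤-trans
                                        (sum-lowerBound 2 _ edge-weight) (matching-∑-≤ M weight)) ⟩
    ∣ Y ∣ + sum weight            ≡⟨ cong (_+_ (∣ Y ∣)) sum-weight ⟩
    ∣ Y ∣ + (∣ ∁ Y ∣ + ∣ N G Y ∣) ≡⟨ NP.+-assoc (∣ Y ∣) _ _ ⟨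
    ∣ Y ∣ + ∣ ∁ Y ∣ + ∣ N G Y ∣   ≡⟨ cong (λ k → k + ∣ N G Y ∣) (∣p∣+∣∁p∣≡n Y) ⟩
    n + ∣ N G Y ∣ ∎
    where
    open NP.≤-Reasoning
    weight : Fin n → ℕ
    weight v = toℕ (not (lookup Y v)) + toℕ (lookup (N G Y) v)
    sum-weight : sum weight ≡ ∣ ∁ Y ∣ + ∣ N G Y ∣
    sum-weight = trans (∑-distrib-+ (λ v → toℕ (not (lookup Y v))) (λ v → toℕ (lookup (N G Y) v)))
      (cong₂ _+_
      (trans (sum-cong-≗ (λ v → cong toℕ (sym (VP.lookup-map v not Y)))) (sym (∣p∣≡∑ (∁ Y))))
      (sym (∣p∣≡∑ (N G Y))))
    edge-weight : ∀ i → 2 ≤ weight (proj₁ (f i)) + weight (proj₂ (f i))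
    edge-weight i = 2≤edgeWeight (lookup Y u) (lookup (N G Y) u) (lookup Y w) (lookup (N G Y) w)
      (λ Yu≡true → ∈⇒lookup (∈N⁺ (lookup⇒∈ {p = Y} Yu≡true) (edges i)))
      (λ Yw≡true → ∈⇒lookup (∈N⁺ (lookup⇒∈ {p = Y} Yw≡true) (trans (Graph.sym G w u) (edges i))))
      where
      u w : Fin n
      u = proj₁ (f i)
      w = proj₂ (f i)

  independent-critical : ∀ {m f S} → IsMatching G m f → Independent G S → ∣ S ∣ + m ≡ n →
                         Critical G S
  independent-critical {m} {f} {S} M S-independent ∣S∣+m≡n Y = ZP.≤-trans
    ([+m]-[+n]≤[+o]-[+p] (∣ Y ∣) (∣ N G Y ∣) (∣ S ∣) m
      (cancel (∣ Y ∣) (∣ S ∣) (∣ N G Y ∣) m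
        (subst (λ k → ∣ Y ∣ + m * 2 ≤ k + ∣ N G Y ∣) (sym ∣S∣+m≡n) (matching⇒∣Y∣+m*2≤n+∣NY∣ M Y))))
    ([+m]-[+n]≤[+o]-[+p] (∣ S ∣) m (∣ S ∣) (∣ N G S ∣)
      (subst (λ k → ∣ S ∣ + ∣ N G S ∣ ≤ k) (sym ∣S∣+m≡n) (independent⇒∣S∣+∣NS∣≤n S-independent)))
    where
    cancel : ∀ y s k m → y + m * 2 ≤ (s + m) + k → y + m ≤ s + k
    cancel y s k m le = NP.+-cancelʳ-≤ m (y + m) (s + k)
      (subst₂ _≤_ (lhs y m) (rhs s k m) le)
      where
      lhs : ∀ y m → y + m * 2 ≡ y + m + m
      lhs = ℕ-Solver.solve-∀
      rhs : ∀ s k m → s + m + k ≡ s + k + m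
      rhs = ℕ-Solver.solve-∀

  module _ {F : Subset n → Set} (F? : Decidable F) (F⇒critical : ∀ {S} → F S → Critical G S)
           {S₀ : Subset n} (F-S₀ : F S₀) where

    -- S₀ keeps the family nonempty: ⋂ [] = ⊤ need not be critical.
    private
      members : List (Subset n)
      members = filter F? (subsets n)

      ∈-members : ∀ {S} → F S → S List.∈ members
      ∈-members {S} F-S = ∈-filter⁺ F? (∈-subsets S) F-S

      members-satisfy : ∀ {S} → S List.∈ members → F S
      members-satisfy = proj₂ ∘ ∈-filter⁻ F? {xs = subsets n}

    ⋂-family-critical : ∀ C → (∀ v → (v ∈ C → ∀ S → F S → v ∈ S) × ((∀ S → F S → v ∈ S) → v ∈ C)) →
                        Critical G C
    ⋂-family-critical C C-is-⋂F = subst (Critical G) (sym C≡⋂members)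
      (⋂-critical S₀ members (F⇒critical F-S₀) (All.tabulate (F⇒critical ∘ members-satisfy)))
      where
      C≡⋂members : C ≡ ⋂ (S₀ ∷ members)
      C≡⋂members = ⊆-antisym
        (λ {v} v∈C → let v∈F = proj₁ (C-is-⋂F v) v∈C in
          x∈p∩q⁺ (v∈F S₀ F-S₀ , x∈⋂⁺ (All.tabulate (v∈F _ ∘ members-satisfy))))
        (λ {v} v∈⋂ → proj₂ (C-is-⋂F v) λ S F-S →
          All.lookup (x∈⋂⁻ members (proj₂ (x∈p∩q⁻ S₀ _ v∈⋂))) (∈-members F-S))

    ⋃-family-critical : ∀ K → (∀ v → (v ∈ K → Σ (Subset n) λ S → F S × v ∈ S) ×
                                      ((Σ (Subset n) λ S → F S × v ∈ S) → v ∈ K)) →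
                        Critical G K
    ⋃-family-critical K K-is-⋃F = subst (Critical G) (sym K≡⋃members)
      (⋃-critical S₀ members (F⇒critical F-S₀) (All.tabulate (F⇒critical ∘ members-satisfy)))
      where
      from-members : ∀ {v} → v ∈ ⋃ members → Σ (Subset n) λ S → F S × v ∈ S
      from-members v∈⋃members =
        let S , S∈ , v∈S = List.find (x∈⋃⁻ members v∈⋃members) in S , members-satisfy S∈ , v∈S
      K≡⋃members : K ≡ ⋃ (S₀ ∷ members)
      K≡⋃members = ⊆-antisym
        (λ {v} v∈K → let S , F-S , v∈S = proj₁ (K-is-⋃F v) v∈K in
          x∈p∪q⁺ (inj₂ (x∈⋃⁺ (List.lose (∈-members F-S) v∈S))))
        (λ {v} v∈⋃ → proj₂ (K-is-⋃F v) ([ (λ v∈S₀ → S₀ , F-S₀ , v∈S₀) , from-members ]′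
                                          (x∈p∪q⁻ S₀ _ v∈⋃)))

  independent? : Decidable (Independent G)
  independent? S = FP.all? λ u → FP.all? λ v →
    (u ∈? S) →-dec ((v ∈? S) →-dec (adj G u v BP.≟ false))

  maximumIndependent⇒∣S∣≡∣T∣ : ∀ {S T} → MaximumIndependent G S → MaximumIndependent G T →
                               ∣ S ∣ ≡ ∣ T ∣
  maximumIndependent⇒∣S∣≡∣T∣ {S} {T} (S-independent , S-maximum) (T-independent , T-maximum) =
    NP.≤-antisym (T-maximum S S-independent) (S-maximum T T-independent)

  maximumIndependent? : ∀ {S₀} → MaximumIndependent G S₀ → Decidable (MaximumIndependent G)
  maximumIndependent? {S₀} S₀-mis@(_ , S₀-maximum) S =
    map′ (λ (S-independent , ∣S∣≡∣S₀∣) → S-independent , λ I I-independent →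
           subst (∣ I ∣ ≤_) (sym ∣S∣≡∣S₀∣) (S₀-maximum I I-independent))
         (λ S-mis → proj₁ S-mis , maximumIndependent⇒∣S∣≡∣T∣ S-mis S₀-mis)
         (independent? S ×-dec (∣ S ∣ NP.≟ ∣ S₀ ∣))

  maximumIndependent⇒maximumCriticalIndependent : ∀ {S} → MaximumIndependent G S → Critical G S →
                                                  MaximumCriticalIndependent G S
  maximumIndependent⇒maximumCriticalIndependent (S-independent , S-maximum) S-critical =
    (S-independent , λ I _ → S-critical I) , λ B (B-independent , _) → S-maximum B B-independent

  maximumCriticalIndependent⇒maximumIndependent :
    ∀ {S₀ A} → MaximumIndependent G S₀ → Critical G S₀ →
    MaximumCriticalIndependent G A → MaximumIndependent G A
  maximumCriticalIndependent⇒maximumIndependent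
    (S₀-independent , S₀-maximum) S₀-critical ((A-independent , _) , A-maximum) =
    A-independent , λ I I-independent →
      NP.≤-trans (S₀-maximum I I-independent) (A-maximum _ (S₀-independent , λ I _ → S₀-critical I))

  corona⇒unionMaxCritIndep : ∀ {S₀ K} → MaximumIndependent G S₀ →
                             (∀ {S} → MaximumIndependent G S → Critical G S) →
                             IsCorona G K → IsUnionMaxCritIndep G K
  corona⇒unionMaxCritIndep S₀-mis mis-critical K-corona v =
    (λ v∈K → let S , S-mis , v∈S = proj₁ (K-corona v) v∈K in
      S , maximumIndependent⇒maximumCriticalIndependent S-mis (mis-critical S-mis) , v∈S) ,
    (λ (A , A-mcis , v∈A) → proj₂ (K-corona v)
      (A , maximumCriticalIndependent⇒maximumIndependent S₀-mis (mis-critical S₀-mis) A-mcis , v∈A))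

corollary2p3 : {n : ℕ} (G : Graph n) → KonigEgervary G →
    (∀ (C : Subset n) → IsCore G C → Critical G C) ×
    (∀ (K : Subset n) → IsCorona G K → Critical G K × IsUnionMaxCritIndep G K)
corollary2p3 G (a , m , (S₀ , S₀-mis , ∣S₀∣≡a) , ((f , M) , _) , a+m≡n) =
  ⋂-family-critical G mis? mis-critical S₀-mis ,
  λ K K-corona → ⋃-family-critical G mis? mis-critical S₀-mis K K-corona ,
                 corona⇒unionMaxCritIndep G S₀-mis mis-critical K-corona
  where
  mis? : Decidable (MaximumIndependent G)
  mis? = maximumIndependent? G S₀-mis
  mis-critical : ∀ {S} → MaximumIndependent G S → Critical G S
  mis-critical S-mis = independent-critical G M (proj₁ S-mis)
    (trans (cong (λ k → k + m) (trans (maximumIndependent⇒∣S∣≡∣T∣ G S-mis S₀-mis) ∣S₀∣≡a)) a+m≡n)
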